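{- Let $m,n\in\mathbb{N}$ and let $G=K_{1,m,n}$ be the complete tripartite graph with parts of sizes $1,m,n$. Then: (1) if $m=1$, $G$ is an $\mathcal{N}$ position of Grim if and only if $n$ is even; (2) if $m=2$ and $n\ge 2$, $G$ is an $\mathcal{N}$ position; (3) if $m,n\ge 3$, $G$ is an $\mathcal{N}$ position if and only if $m+n$ is even.
   Context: Grim: two players alternate moves on a finite simple undirected graph. Before play, isolated vertices are deleted. A move consists of choosing a remaining vertex and deleting it together with its incident edges, and then deleting every vertex that has become isolated. The player making the last move wins (a player with no available move loses). A graph is an $\mathcal{N}$ position if the player about to move has a winning strategy, and a $\mathcal{P}$ position otherwise. -}

module Defs where

open import Data.Nat using (ℕ; zero; suc; _+_; _<ᵇ_)
open import Data.Fin using (Fin; toℕ) renaming (zero to fzero; suc to fsuc)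
import Data.Fin.Properties as FinP
import Data.Nat.Properties as NatP
open import Data.Bool using (Bool; true; false; _∧_; _∨_; not; if_then_else_)
open import Relation.Nullary using (¬_; Dec)
open import Relation.Nullary.Decidable using (⌊_⌋; ¬?)
open import Relation.Binary.PropositionalEquality using (_≡_; _≢_; refl) renaming (sym to ≡-sym)

record SimpleGraph : Set₁ where
  field
    size   : ℕ
    Adj    : Fin size → Fin size → Set
    adj?   : (u v : Fin size) → Dec (Adj u v)
    symm   : ∀ {u v} → Adj u v → Adj v u
    irrefl : ∀ {u} → ¬ Adj u u

anyFin : (k : ℕ) → (Fin k → Bool) → Bool
anyFin zero    f = false
anyFin (suc k) f = f fzero ∨ anyFin k (λ i → f (fsuc i))

module Grim (G : SimpleGraph) where
  open SimpleGraph G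

  -- A position: the set of remaining vertices (characteristic function).
  Position : Set
  Position = Fin size → Bool

  removeIsolated : Position → Position
  removeIsolated T u = T u ∧ anyFin size (λ w → T w ∧ ⌊ adj? u w ⌋)

  move : Position → Fin size → Position
  move S v = removeIsolated (λ u → S u ∧ not ⌊ u FinP.≟ v ⌋)

  start : Position
  start = removeIsolated (λ _ → true)

  -- Normal play: the player to move wins iff some legal move leads to a
  -- position in which the player to move loses.  (Finite game, so the
  -- inductive definitions capture winning strategies.)
  data Win  : Position → Set
  data Lose : Position → Set

  data Win where
    win : ∀ {S} (v : Fin size) → S v ≡ true → Lose (move S v) → Win S

  data Lose where
    lose : ∀ {S} → (∀ (v : Fin size) → S v ≡ true → Win (move S v)) → Lose S

  NPosition : Set
  NPosition = Win start

  PPosition : Set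
  PPosition = ¬ NPosition

-- Complete tripartite graph K_{a,b,c}: vertices 0..a-1 form part 0,
-- a..a+b-1 part 1, a+b..a+b+c-1 part 2; adjacent iff in different parts.
part : (a b : ℕ) → ℕ → ℕ
part a b i = if i <ᵇ a then 0 else (if i <ᵇ a + b then 1 else 2)

K3 : (a b c : ℕ) → SimpleGraph
K3 a b c = record
  { size   = a + b + c
  ; Adj    = λ u v → part a b (toℕ u) ≢ part a b (toℕ v)
  ; adj?   = λ u v → ¬? (part a b (toℕ u) NatP.≟ part a b (toℕ v))
  ; symm   = λ p q → p (≡-sym q)
  ; irrefl = λ p → p refl
  }

IsN : SimpleGraph → Set
IsN G = Grim.NPosition G

module Submission where

open import Defs
open import Algebra.Bundles using (CommutativeMonoid)
open import Data.Bool using (Bool; true; false; _∧_; _∨_; not; if_then_else_)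
open import Data.Bool.Properties
  using (∧-zeroʳ; ∧-identityʳ; ∧-conicalˡ; ∧-conicalʳ; ∧-commutativeMonoid; T-≡)
open import Data.Empty using (⊥-elim)
open import Data.Fin using (Fin; toℕ) renaming (zero to fzero; suc to fsuc)
import Data.Fin.Properties as FinP
open import Data.Nat using (ℕ; zero; suc; _+_; _*_; _≥_; _≡ᵇ_; _<ᵇ_; parity; s≤s; z≤n)
import Data.Nat.Properties as NatP
open import Data.Nat.Divisibility using (_∣_; divides)
open import Data.Parity.Base using (0ℙ; 1ℙ; _⁻¹)
open import Data.Parity.Properties using (suc-homo-⁻¹)
open import Data.Product using (_×_; _,_; proj₁; proj₂; ∃-syntax)
open import Data.Sum using (_⊎_; inj₁; inj₂)
open import Function using (_∘_)
open import Function.Bundles using (_⇔_; mk⇔; Equivalence)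
open import Relation.Nullary using (¬_)
open import Relation.Nullary.Decidable using (⌊_⌋; isYes≗does; ⌊⌋-map′)
open import Relation.Binary.PropositionalEquality
  using (_≡_; refl; sym; trans; cong; cong₂; subst; module ≡-Reasoning)
open import Algebra.Properties.CommutativeSemigroup NatP.+-commutativeSemigroup
  using (x∙yz≈y∙xz; x∙yz≈y∙zx)
open import Algebra.Properties.CommutativeSemigroup
  (CommutativeMonoid.commutativeSemigroup ∧-commutativeMonoid)
  using () renaming (xy∙z≈xz∙y to ∧-swapʳ)

open ≡-Reasoning

-- In a complete multipartite graph a vertex is adjacent to everything outside its
-- own part, so a Grim position is determined by its part sizes, and a part vanishes
-- exactly when all other parts are empty.  On these sizes the game is solved by
-- induction: K_{a,b} with a, b ≥ 2 is a 𝒫 position iff a + b is even; K_{1,1,n} is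
-- 𝒩 iff n is even; K_{1,2,n} is 𝒩 (move to K_{2,n} or to K_{1,1,n} according to the
-- parity of n); and for m, n ≥ 3 taking the centre of K_{1,m,n} reaches the
-- bipartite K_{m,n}, while every move from K_{1,m,n} with m + n odd reaches an 𝒩
-- position.

fromBool : Bool → ℕ
fromBool true  = 1
fromBool false = 0

count : (k : ℕ) → (Fin k → Bool) → ℕ
count zero    f = 0
count (suc k) f = fromBool (f fzero) + count k (f ∘ fsuc)

count-cong : ∀ k {f g : Fin k → Bool} → (∀ i → f i ≡ g i) → count k f ≡ count k g
count-cong zero    f≗g = refl
count-cong (suc k) f≗g = cong₂ _+_ (cong fromBool (f≗g fzero)) (count-cong k (f≗g ∘ fsuc))

anyFin-cong : ∀ k {f g : Fin k → Bool} → (∀ i → f i ≡ g i) → anyFin k f ≡ anyFin k g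
anyFin-cong zero    f≗g = refl
anyFin-cong (suc k) f≗g = cong₂ _∨_ (f≗g fzero) (anyFin-cong k (f≗g ∘ fsuc))

anyFin≡count≢0 : ∀ k (f : Fin k → Bool) → anyFin k f ≡ not (count k f ≡ᵇ 0)
anyFin≡count≢0 zero    f = refl
anyFin≡count≢0 (suc k) f with f fzero
... | true  = refl
... | false = anyFin≡count≢0 k (f ∘ fsuc)

count≡suc⇒∃ : ∀ k (f : Fin k → Bool) {c} → count k f ≡ suc c → ∃[ i ] f i ≡ true
count≡suc⇒∃ (suc k) f eq with f fzero in f0
... | true  = fzero , f0
... | false with count≡suc⇒∃ k (f ∘ fsuc) eq
...   | i , fi = fsuc i , fi

count-const : ∀ k b → count k (λ _ → b) ≡ (if b then k else 0)
count-const zero    true  = refl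
count-const zero    false = refl
count-const (suc k) true  = cong suc (count-const k true)
count-const (suc k) false = count-const k false

count-∧ʳ : ∀ k (f : Fin k → Bool) b → count k (λ i → f i ∧ b) ≡ (if b then count k f else 0)
count-∧ʳ k f true  = count-cong k (∧-identityʳ ∘ f)
count-∧ʳ k f false = trans (count-cong k (∧-zeroʳ ∘ f)) (count-const k false)

count-split : ∀ k (f g : Fin k → Bool) →
  count k f ≡ count k (λ i → f i ∧ g i) + count k (λ i → f i ∧ not (g i))
count-split zero    f g = refl
count-split (suc k) f g
  rewrite count-split k (f ∘ fsuc) (g ∘ fsuc) with f fzero | g fzero
... | true  | true  = refl
... | true  | false = sym (NatP.+-suc _ _)
... | false | _     = refl

count-remove : ∀ k (f : Fin k → Bool) v →
  count k f ≡ fromBool (f v) + count k (λ i → f i ∧ not ⌊ i FinP.≟ v ⌋)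
count-remove (suc k) f fzero = cong (fromBool (f fzero) +_)
  (cong₂ (λ b n → fromBool b + n) (sym (∧-zeroʳ (f fzero))) (sym (count-∧ʳ k (f ∘ fsuc) true)))
count-remove (suc k) f (fsuc v) = begin
  fromBool (f fzero) + count k (f ∘ fsuc)
    ≡⟨ cong (fromBool (f fzero) +_) (count-remove k (f ∘ fsuc) v) ⟩
  fromBool (f fzero) + (fromBool (f (fsuc v)) + rest)
    ≡⟨ x∙yz≈y∙xz (fromBool (f fzero)) (fromBool (f (fsuc v))) rest ⟩
  fromBool (f (fsuc v)) + (fromBool (f fzero) + rest)
    ≡⟨ cong₂ (λ b n → fromBool (f (fsuc v)) + (fromBool b + n))
         (sym (∧-identityʳ (f fzero)))
         (count-cong k (λ i → cong (λ b → f (fsuc i) ∧ not b) (sym (⌊⌋-map′ _ _ (i FinP.≟ v))))) ⟩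
  fromBool (f (fsuc v)) + count (suc k) (λ i → f i ∧ not ⌊ i FinP.≟ fsuc v ⌋) ∎
  where rest = count k (λ i → f (fsuc i) ∧ not ⌊ i FinP.≟ v ⌋)

≡ᵇ⇒≡ : ∀ {p q} → (p ≡ᵇ q) ≡ true → p ≡ q
≡ᵇ⇒≡ {p} {q} eq = NatP.≡ᵇ⇒≡ p q (Equivalence.from T-≡ eq)

∧-≡ᵇ-subst : ∀ (h : ℕ → Bool) t p q → (t ∧ h q) ∧ (p ≡ᵇ q) ≡ (t ∧ (p ≡ᵇ q)) ∧ h p
∧-≡ᵇ-subst h false p q = refl
∧-≡ᵇ-subst h true  p q with p ≡ᵇ q in p≡q
... | false = ∧-zeroʳ (h q)
... | true  = trans (∧-identityʳ (h q)) (cong h (sym (≡ᵇ⇒≡ p≡q)))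

count-part : ∀ a b c (h : ℕ → Bool) → count (a + b + c) (λ i → h (part a b (toℕ i))) ≡
  count a (λ _ → h 0) + (count b (λ _ → h 1) + count c (λ _ → h 2))
count-part (suc a) b c h =
  trans (cong (fromBool (h 0) +_) (count-part a b c h)) (sym (NatP.+-assoc (fromBool (h 0)) _ _))
count-part zero (suc b) c h =
  trans (cong (fromBool (h 1) +_) (count-part zero b c h)) (sym (NatP.+-assoc (fromBool (h 1)) _ _))
count-part zero zero c h = refl

part-cases : ∀ a b t → part a b t ≡ 0 ⊎ part a b t ≡ 1 ⊎ part a b t ≡ 2
part-cases a b t with t <ᵇ a
... | true = inj₁ refl
... | false with t <ᵇ a + b
...   | true  = inj₂ (inj₁ refl)
...   | false = inj₂ (inj₂ refl)

parity-pred : ∀ k {p} → parity (suc k) ≡ p → parity k ≡ p ⁻¹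
parity-pred k e = trans (sym (suc-homo-⁻¹ k)) (cong _⁻¹ e)

parity-predʳ : ∀ m n {p} → parity (m + suc n) ≡ p → parity (m + n) ≡ p ⁻¹
parity-predʳ m n e = parity-pred (m + n) (trans (cong parity (sym (NatP.+-suc m n))) e)

parity≡0ℙ⇒2∣ : ∀ n → parity n ≡ 0ℙ → 2 ∣ n
parity≡0ℙ⇒2∣ zero          _ = divides 0 refl
parity≡0ℙ⇒2∣ (suc (suc n)) e with parity≡0ℙ⇒2∣ n e
... | divides q n≡q*2 = divides (suc q) (cong (suc ∘ suc) n≡q*2)

2∣⇒parity≡0ℙ : ∀ {n} → 2 ∣ n → parity n ≡ 0ℙ
2∣⇒parity≡0ℙ (divides q refl) = even q
  where
  even : ∀ q → parity (q * 2) ≡ 0ℙ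
  even zero    = refl
  even (suc q) = even q

parity-cases⇒⇔2∣ : ∀ {A : Set} k → (parity k ≡ 0ℙ → A) → (parity k ≡ 1ℙ → ¬ A) → A ⇔ 2 ∣ k
parity-cases⇒⇔2∣ {A} k even⇒A odd⇒¬A = mk⇔ A⇒2∣ (even⇒A ∘ 2∣⇒parity≡0ℙ)
  where
  A⇒2∣ : A → 2 ∣ k
  A⇒2∣ x with parity k in e
  ... | 0ℙ = parity≡0ℙ⇒2∣ k e
  ... | 1ℙ = ⊥-elim (odd⇒¬A refl x)

-- In K_{x,y,z} the vertices of the part of size y become isolated exactly when
-- the other two parts (of sizes u and w) are empty.
survive : (u w y : ℕ) → ℕ
survive u w y = if not (u + w ≡ᵇ 0) then y else 0

survive-comm : ∀ u w y → survive u w y ≡ survive w u y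
survive-comm u w y = cong (λ s → if not (s ≡ᵇ 0) then y else 0) (NatP.+-comm u w)

data Win₃  : ℕ → ℕ → ℕ → Set
data Lose₃ : ℕ → ℕ → ℕ → Set

data Win₃ where
  take₀ : ∀ {x y z} → Lose₃ (survive y z x) (survive x z y) (survive x y z) → Win₃ (suc x) y z
  take₁ : ∀ {x y z} → Lose₃ (survive y z x) (survive x z y) (survive x y z) → Win₃ x (suc y) z
  take₂ : ∀ {x y z} → Lose₃ (survive y z x) (survive x z y) (survive x y z) → Win₃ x y (suc z)

data Lose₃ where
  lose₃ : ∀ {x y z} →
    (∀ {x′} → x ≡ suc x′ → Win₃ (survive y z x′) (survive x′ z y) (survive x′ y z)) →
    (∀ {y′} → y ≡ suc y′ → Win₃ (survive y′ z x) (survive x z y′) (survive x y′ z)) →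
    (∀ {z′} → z ≡ suc z′ → Win₃ (survive y z′ x) (survive x z′ y) (survive x y z′)) →
    Lose₃ x y z

Win₃-cast : ∀ {u w x y z} → Win₃ (survive u w x) y z → Win₃ (survive w u x) y z
Win₃-cast {u} {w} {x} {y} {z} = subst (λ s → Win₃ s y z) (survive-comm u w x)

Lose₃-cast : ∀ {u w x y z} → Lose₃ (survive u w x) y z → Lose₃ (survive w u x) y z
Lose₃-cast {u} {w} {x} {y} {z} = subst (λ s → Lose₃ s y z) (survive-comm u w x)

Win₃-swap  : ∀ {x y z} → Win₃ x y z → Win₃ x z y
Lose₃-swap : ∀ {x y z} → Lose₃ x y z → Lose₃ x z y

Win₃-swap (take₀ {y = y} {z} l) = take₀ (Lose₃-cast {y} {z} (Lose₃-swap l))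
Win₃-swap (take₁ {y = y} {z} l) = take₂ (Lose₃-cast {y} {z} (Lose₃-swap l))
Win₃-swap (take₂ {y = y} {z} l) = take₁ (Lose₃-cast {y} {z} (Lose₃-swap l))

Lose₃-swap {y = y} {z} (lose₃ f₀ f₁ f₂) = lose₃
  (λ e → Win₃-cast {y} {z} (Win₃-swap (f₀ e)))
  (λ {z′} e → Win₃-cast {y} {z′} (Win₃-swap (f₂ e)))
  (λ {y′} e → Win₃-cast {y′} {z} (Win₃-swap (f₁ e)))

Lose₃-empty : Lose₃ 0 0 0
Lose₃-empty = lose₃ (λ ()) (λ ()) (λ ())

Win₃-star : ∀ n → Win₃ 0 1 (suc n)
Win₃-star n = take₁ Lose₃-empty

Lose₃-bipartite : ∀ a b → parity (2 + a + (2 + b)) ≡ 0ℙ → Lose₃ 0 (2 + a) (2 + b)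
Win₃-bipartite  : ∀ a b → parity (2 + a + (2 + b)) ≡ 1ℙ → Win₃ 0 (2 + a) (2 + b)

Lose₃-bipartite a b e = lose₃ (λ ()) (λ { refl → shrink₁ a e }) (λ { refl → shrink₂ b e })
  where
  shrink₁ : ∀ a → parity (2 + a + (2 + b)) ≡ 0ℙ → Win₃ 0 (1 + a) (2 + b)
  shrink₁ zero    e = Win₃-star (suc b)
  shrink₁ (suc a) e = Win₃-bipartite a b (parity-pred (2 + a + (2 + b)) e)
  shrink₂ : ∀ b → parity (2 + a + (2 + b)) ≡ 0ℙ → Win₃ 0 (2 + a) (1 + b)
  shrink₂ zero    e = Win₃-swap (Win₃-star (suc a))
  shrink₂ (suc b) e = Win₃-bipartite a b (parity-predʳ (2 + a) (2 + b) e)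

Win₃-bipartite (suc a) b    e = take₁ (Lose₃-bipartite a b (parity-pred (2 + a + (2 + b)) e))
Win₃-bipartite zero (suc b) e = take₂ (Lose₃-bipartite 0 b (parity-pred b e))

Win₃-K₁₁  : ∀ n → parity n ≡ 0ℙ → Win₃ 1 1 n
Lose₃-K₁₁ : ∀ n → parity n ≡ 1ℙ → Lose₃ 1 1 n

Win₃-K₁₁ zero    e = take₀ Lose₃-empty
Win₃-K₁₁ (suc n) e = take₂ (Lose₃-K₁₁ n (parity-pred n e))

Lose₃-K₁₁ (suc n) e = lose₃
  (λ { refl → Win₃-star n })
  (λ { refl → take₀ Lose₃-empty })
  (λ { refl → Win₃-K₁₁ n (parity-pred n e) })

Win₃-K₁₂ : ∀ n → Win₃ 1 2 n
Win₃-K₁₂ zero          = take₀ Lose₃-empty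
Win₃-K₁₂ (suc zero)    = take₁ (Lose₃-K₁₁ 1 refl)
Win₃-K₁₂ (suc (suc n)) with parity n in e
... | 0ℙ = take₀ (Lose₃-bipartite 0 n e)
... | 1ℙ = take₁ (Lose₃-K₁₁ (2 + n) e)

Win₃-K₁  : ∀ a b → parity (3 + a + (3 + b)) ≡ 0ℙ → Win₃ 1 (3 + a) (3 + b)
Lose₃-K₁ : ∀ a b → parity (3 + a + (3 + b)) ≡ 1ℙ → Lose₃ 1 (3 + a) (3 + b)

Win₃-K₁ a b e = take₀ (Lose₃-bipartite (suc a) (suc b) e)

Lose₃-K₁ a b e = lose₃
  (λ { refl → Win₃-bipartite (suc a) (suc b) e })
  (λ { refl → shrink₁ a e })
  (λ { refl → shrink₂ b e })
  where
  shrink₁ : ∀ a → parity (3 + a + (3 + b)) ≡ 1ℙ → Win₃ 1 (2 + a) (3 + b)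
  shrink₁ zero    e = Win₃-K₁₂ (3 + b)
  shrink₁ (suc a) e = Win₃-K₁ a b (parity-pred (3 + a + (3 + b)) e)
  shrink₂ : ∀ b → parity (3 + a + (3 + b)) ≡ 1ℙ → Win₃ 1 (3 + a) (2 + b)
  shrink₂ zero    e = Win₃-swap (Win₃-K₁₂ (3 + a))
  shrink₂ (suc b) e = Win₃-K₁ a b (parity-predʳ (3 + a) (3 + b) e)

module _ (G : SimpleGraph) where
  open Grim G

  Win⇒¬Lose : ∀ {S} → Win S → ¬ Lose S
  Win⇒¬Lose (win v Sv lost) (lose reply) = Win⇒¬Lose (reply v Sv) lost

module Tripartite (a b c : ℕ) where
  open Grim (K3 a b c)
  open SimpleGraph (K3 a b c) using (adj?)

  partOf : Fin (a + b + c) → ℕ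
  partOf i = part a b (toℕ i)

  size : Position → ℕ → ℕ
  size S p = count (a + b + c) (λ i → S i ∧ (p ≡ᵇ partOf i))

  outside : Position → ℕ → ℕ
  outside S p = count (a + b + c) (λ i → S i ∧ not (p ≡ᵇ partOf i))

  Counts : Position → ℕ → ℕ → ℕ → Set
  Counts S x y z = size S 0 ≡ x × size S 1 ≡ y × size S 2 ≡ z

  count≡size+outside : ∀ S p → count (a + b + c) S ≡ size S p + outside S p
  count≡size+outside S p = count-split (a + b + c) S (λ i → p ≡ᵇ partOf i)

  count≡size₀+size₁+size₂ : ∀ S → count (a + b + c) S ≡ size S 0 + (size S 1 + size S 2)
  count≡size₀+size₁+size₂ S = begin
    count (a + b + c) S
      ≡⟨ count≡size+outside S 0 ⟩
    size S 0 + outside S 0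
      ≡⟨ cong (size S 0 +_) (count-split (a + b + c) _ (λ i → 1 ≡ᵇ partOf i)) ⟩
    size S 0 + (count (a + b + c) (λ i → (S i ∧ not (0 ≡ᵇ partOf i)) ∧ (1 ≡ᵇ partOf i))
              + count (a + b + c) (λ i → (S i ∧ not (0 ≡ᵇ partOf i)) ∧ not (1 ≡ᵇ partOf i)))
      ≡⟨ cong (size S 0 +_) (cong₂ _+_
           (count-cong (a + b + c) (λ i → proj₁ (not-part₀ (S i) (part-cases a b (toℕ i)))))
           (count-cong (a + b + c) (λ i → proj₂ (not-part₀ (S i) (part-cases a b (toℕ i)))))) ⟩
    size S 0 + (size S 1 + size S 2) ∎
    where
    not-part₀ : ∀ t {s} → s ≡ 0 ⊎ s ≡ 1 ⊎ s ≡ 2 →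
      ((t ∧ not (0 ≡ᵇ s)) ∧ (1 ≡ᵇ s) ≡ t ∧ (1 ≡ᵇ s)) ×
      ((t ∧ not (0 ≡ᵇ s)) ∧ not (1 ≡ᵇ s) ≡ t ∧ (2 ≡ᵇ s))
    not-part₀ false _                  = refl , refl
    not-part₀ true  (inj₁ refl)        = refl , refl
    not-part₀ true  (inj₂ (inj₁ refl)) = refl , refl
    not-part₀ true  (inj₂ (inj₂ refl)) = refl , refl

  outside≡ : ∀ S p q r → size S p + (size S q + size S r) ≡ size S 0 + (size S 1 + size S 2) →
    outside S p ≡ size S q + size S r
  outside≡ S p q r reorder = NatP.+-cancelˡ-≡ (size S p) _ _
    (trans (sym (count≡size+outside S p)) (trans (count≡size₀+size₁+size₂ S) (sym reorder)))

  size-removeIsolated : ∀ S p q r → outside S p ≡ size S q + size S r →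
    size (removeIsolated S) p ≡ survive (size S q) (size S r) (size S p)
  size-removeIsolated S p q r outside≡q+r = begin
    count (a + b + c) (λ i → (S i ∧ anyFin (a + b + c) (λ w → S w ∧ ⌊ adj? i w ⌋)) ∧ (p ≡ᵇ partOf i))
      ≡⟨ count-cong (a + b + c) (λ i → trans
           (cong (λ h → (S i ∧ h) ∧ (p ≡ᵇ partOf i)) (hasNeighbour≡ S i))
           (∧-≡ᵇ-subst (hasVertexOutside S) (S i) p (partOf i))) ⟩
    count (a + b + c) (λ i → (S i ∧ (p ≡ᵇ partOf i)) ∧ hasVertexOutside S p)
      ≡⟨ count-∧ʳ (a + b + c) _ (hasVertexOutside S p) ⟩
    (if hasVertexOutside S p then size S p else 0)
      ≡⟨ cong (λ h → if h then size S p else 0)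
           (trans (anyFin≡count≢0 (a + b + c) _) (cong (λ o → not (o ≡ᵇ 0)) outside≡q+r)) ⟩
    survive (size S q) (size S r) (size S p) ∎
    where
    hasVertexOutside : Position → ℕ → Bool
    hasVertexOutside S q = anyFin (a + b + c) (λ w → S w ∧ not (q ≡ᵇ partOf w))
    hasNeighbour≡ : ∀ S i →
      anyFin (a + b + c) (λ w → S w ∧ ⌊ adj? i w ⌋) ≡ hasVertexOutside S (partOf i)
    hasNeighbour≡ S i = anyFin-cong (a + b + c) (λ w → cong (S w ∧_) (isYes≗does (adj? i w)))

  Counts-removeIsolated : ∀ {S x y z} → Counts S x y z →
    Counts (removeIsolated S) (survive y z x) (survive x z y) (survive x y z)
  Counts-removeIsolated {S} (refl , refl , refl) =
    size-removeIsolated S 0 1 2 (outside≡ S 0 1 2 refl) ,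
    size-removeIsolated S 1 0 2 (outside≡ S 1 0 2 (x∙yz≈y∙xz (size S 1) (size S 0) (size S 2))) ,
    size-removeIsolated S 2 0 1 (outside≡ S 2 0 1 (x∙yz≈y∙zx (size S 2) (size S 0) (size S 1)))

  delete : Position → Fin (a + b + c) → Position
  delete S v u = S u ∧ not ⌊ u FinP.≟ v ⌋

  size-delete : ∀ S {v q} → S v ≡ true → partOf v ≡ q → ∀ p →
    size S p ≡ fromBool (p ≡ᵇ q) + size (delete S v) p
  size-delete S {v} Sv refl p = begin
    size S p
      ≡⟨ count-remove (a + b + c) _ v ⟩
    fromBool (S v ∧ (p ≡ᵇ partOf v))
      + count (a + b + c) (λ i → (S i ∧ (p ≡ᵇ partOf i)) ∧ not ⌊ i FinP.≟ v ⌋)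
      ≡⟨ cong₂ _+_ (cong (λ t → fromBool (t ∧ (p ≡ᵇ partOf v))) Sv)
                   (count-cong (a + b + c) (λ i → ∧-swapʳ (S i) _ _)) ⟩
    fromBool (p ≡ᵇ partOf v) + size (delete S v) p ∎

  Counts-delete₀ : ∀ {S v x y z} → S v ≡ true → partOf v ≡ 0 → Counts S x y z →
    ∃[ x′ ] x ≡ suc x′ × Counts (delete S v) x′ y z
  Counts-delete₀ {S} Sv v∈0 (s₀ , s₁ , s₂) =
    _ , trans (sym s₀) (del 0) , refl , trans (sym (del 1)) s₁ , trans (sym (del 2)) s₂
    where del = size-delete S Sv v∈0

  Counts-delete₁ : ∀ {S v x y z} → S v ≡ true → partOf v ≡ 1 → Counts S x y z →
    ∃[ y′ ] y ≡ suc y′ × Counts (delete S v) x y′ z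
  Counts-delete₁ {S} Sv v∈1 (s₀ , s₁ , s₂) =
    _ , trans (sym s₁) (del 1) , trans (sym (del 0)) s₀ , refl , trans (sym (del 2)) s₂
    where del = size-delete S Sv v∈1

  Counts-delete₂ : ∀ {S v x y z} → S v ≡ true → partOf v ≡ 2 → Counts S x y z →
    ∃[ z′ ] z ≡ suc z′ × Counts (delete S v) x y z′
  Counts-delete₂ {S} Sv v∈2 (s₀ , s₁ , s₂) =
    _ , trans (sym s₂) (del 2) , trans (sym (del 0)) s₀ , trans (sym (del 1)) s₁ , refl
    where del = size-delete S Sv v∈2

  size≡suc⇒vertex : ∀ S p {k} → size S p ≡ suc k → ∃[ v ] S v ≡ true × partOf v ≡ p
  size≡suc⇒vertex S p eq with count≡suc⇒∃ (a + b + c) _ eq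
  ... | v , Sv∧v∈p = v , ∧-conicalˡ _ _ Sv∧v∈p , sym (≡ᵇ⇒≡ (∧-conicalʳ _ _ Sv∧v∈p))

  Win₃⇒Win   : ∀ {S x y z} → Win₃ x y z → Counts S x y z → Win S
  Lose₃⇒Lose : ∀ {S x y z} → Lose₃ x y z → Counts S x y z → Lose S

  Win₃⇒Win {S} (take₀ lost) counts with size≡suc⇒vertex S 0 (proj₁ counts)
  ... | v , Sv , v∈0 with Counts-delete₀ Sv v∈0 counts
  ...   | _ , refl , counts′ = win v Sv (Lose₃⇒Lose lost (Counts-removeIsolated counts′))
  Win₃⇒Win {S} (take₁ lost) counts with size≡suc⇒vertex S 1 (proj₁ (proj₂ counts))
  ... | v , Sv , v∈1 with Counts-delete₁ Sv v∈1 counts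
  ...   | _ , refl , counts′ = win v Sv (Lose₃⇒Lose lost (Counts-removeIsolated counts′))
  Win₃⇒Win {S} (take₂ lost) counts with size≡suc⇒vertex S 2 (proj₂ (proj₂ counts))
  ... | v , Sv , v∈2 with Counts-delete₂ Sv v∈2 counts
  ...   | _ , refl , counts′ = win v Sv (Lose₃⇒Lose lost (Counts-removeIsolated counts′))

  Lose₃⇒Lose {S} (lose₃ f₀ f₁ f₂) counts = lose reply
    where
    reply : ∀ v → S v ≡ true → Win (move S v)
    reply v Sv with part-cases a b (toℕ v)
    ... | inj₁ v∈0 with Counts-delete₀ Sv v∈0 counts
    ...   | _ , eq , counts′ = Win₃⇒Win (f₀ eq) (Counts-removeIsolated counts′)
    reply v Sv | inj₂ (inj₁ v∈1) with Counts-delete₁ Sv v∈1 counts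
    ...   | _ , eq , counts′ = Win₃⇒Win (f₁ eq) (Counts-removeIsolated counts′)
    reply v Sv | inj₂ (inj₂ v∈2) with Counts-delete₂ Sv v∈2 counts
    ...   | _ , eq , counts′ = Win₃⇒Win (f₂ eq) (Counts-removeIsolated counts′)

  Counts-all : Counts (λ _ → true) a b c
  Counts-all = trans (all-in 0) (NatP.+-identityʳ a) , trans (all-in 1) (NatP.+-identityʳ b) , all-in 2
    where
    all-in : ∀ p → size (λ _ → true) p ≡
      (if p ≡ᵇ 0 then a else 0) + ((if p ≡ᵇ 1 then b else 0) + (if p ≡ᵇ 2 then c else 0))
    all-in p = trans (count-part a b c (p ≡ᵇ_))
      (cong₂ _+_ (count-const a _) (cong₂ _+_ (count-const b _) (count-const c _)))

  Win₃⇒N : Win₃ (survive b c a) (survive a c b) (survive a b c) → IsN (K3 a b c)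
  Win₃⇒N w = Win₃⇒Win w (Counts-removeIsolated Counts-all)

  Lose₃⇒¬N : Lose₃ (survive b c a) (survive a c b) (survive a b c) → ¬ IsN (K3 a b c)
  Lose₃⇒¬N l n = Win⇒¬Lose (K3 a b c) n (Lose₃⇒Lose l (Counts-removeIsolated Counts-all))

lemma3p3 : (m n : ℕ) →
    (m ≡ 1 → (IsN (K3 1 m n) ⇔ 2 ∣ n)) ×
    (m ≡ 2 → n ≥ 2 → IsN (K3 1 m n)) ×
    (m ≥ 3 → n ≥ 3 → (IsN (K3 1 m n) ⇔ 2 ∣ (m + n)))
lemma3p3 m n = K₁₁ₙ , K₁₂ₙ , K₁ₘₙ
  where
  K₁₁ₙ : m ≡ 1 → IsN (K3 1 m n) ⇔ 2 ∣ n
  K₁₁ₙ refl = parity-cases⇒⇔2∣ n (Win₃⇒N ∘ Win₃-K₁₁ n) (Lose₃⇒¬N ∘ Lose₃-K₁₁ n)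
    where open Tripartite 1 1 n

  K₁₂ₙ : m ≡ 2 → n ≥ 2 → IsN (K3 1 m n)
  K₁₂ₙ refl _ = Tripartite.Win₃⇒N 1 2 n (Win₃-K₁₂ n)

  K₁ₘₙ : m ≥ 3 → n ≥ 3 → IsN (K3 1 m n) ⇔ 2 ∣ (m + n)
  K₁ₘₙ (s≤s (s≤s (s≤s (z≤n {a})))) (s≤s (s≤s (s≤s (z≤n {b})))) =
    parity-cases⇒⇔2∣ (m + n) (Win₃⇒N ∘ Win₃-K₁ a b) (Lose₃⇒¬N ∘ Lose₃-K₁ a b)
    where open Tripartite 1 m n
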